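{- (Subformula Property) In the Fitch-style calculus for $IK$: if $\Gamma\vdash t:A$ is derivable and $t$ is normal, then every subterm of $t$ has, as its type in the derivation tree, a subformula of $A$ or a subformula of some type assigned to a variable in $\Gamma$.
   Context: Types: $A,B ::= p \mid 1 \mid A\times B \mid A\to B \mid 0 \mid A+B \mid \Box A$ ($p$ atoms). Contexts: $\Gamma ::= \cdot \mid \Gamma,x:A \mid \Gamma,\bullet$ (variables distinct; $\bullet$ is a structural symbol called a lock). Terms: $x$, $\langle\rangle$, $\langle t,u\rangle$, $\pi_1 t$, $\pi_2 t$, $\lambda x.t$, $t\,u$, $\mathrm{inl}\,t$, $\mathrm{inr}\,t$, $\mathrm{case}\ s\ \mathrm{of}\ (x.t;\,y.u)$, $\mathrm{abort}\,t$, $\mathrm{shut}\,t$, $\mathrm{open}\,t$. Typing rules: (var) $\Gamma,x:A,\Gamma'\vdash x:A$ provided $\Gamma'$ contains no lock; (products) $\Gamma\vdash\langle\rangle:1$; from $\Gamma\vdash t:A$, $\Gamma\vdash u:B$ infer $\Gamma\vdash\langle t,u\rangle:A\times B$; from $\Gamma\vdash t:A_1\times A_2$ infer $\Gamma\vdash\pi_i t:A_i$; (functions) from $\Gamma,x:A\vdash t:B$ infer $\Gamma\vdash\lambda x.t:A\to B$; from $\Gamma\vdash t:A\to B$, $\Gamma\vdash u:A$ infer $\Gamma\vdash t\,u:B$; (sums) from $\Gamma\vdash t:A$ infer $\Gamma\vdash\mathrm{inl}\,t:A+B$; symmetrically for $\mathrm{inr}$; from $\Gamma\vdash s:A+B$,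 $\Gamma,x:A,\Gamma'\vdash t:C$, $\Gamma,y:B,\Gamma'\vdash u:C$ infer $\Gamma,\Gamma'\vdash\mathrm{case}\ s\ \mathrm{of}\ (x.t;\,y.u):C$ (any $\Gamma'$); from $\Gamma\vdash t:0$ infer $\Gamma,\Gamma'\vdash\mathrm{abort}\,t:A$ (any $\Gamma'$); (shut) from $\Gamma,\bullet\vdash t:A$ infer $\Gamma\vdash\mathrm{shut}\,t:\Box A$; (open) from $\Gamma\vdash t:\Box A$ infer $\Gamma,\bullet,\Gamma'\vdash\mathrm{open}\,t:A$ provided $\Gamma'$ contains no lock. Reduction: $\mapsto$ is the closure under all term formers of $(\lambda x.t)\,u\mapsto t[u/x]$; $\pi_i\langle t_1,t_2\rangle\mapsto t_i$; $\mathrm{case}\ (\mathrm{inl}\,s)\ \mathrm{of}\ (x.t;\,y.u)\mapsto t[s/x]$; $\mathrm{case}\ (\mathrm{inr}\,s)\ \mathrm{of}\ (x.t;\,y.u)\mapsto u[s/y]$; $\mathrm{open}\,\mathrm{shut}\,t\mapsto t$; and the commuting conversions $E[\mathrm{case}\ s\ \mathrm{of}\ (x.t;\,y.u)]\mapsto\mathrm{case}\ s\ \mathrm{of}\ (x.E[t];\,y.E[u])$ and $E[\mathrm{abort}\,t]\mapsto\mathrm{abort}\,t$ for every elimination frame $E[-]$ among $[-]\,v$, $\pi_1[-]$, $\pi_2[-]$, $\mathrm{case}\ [-]\ \mathrm{of}\ (\ldots)$, $\mathrm{abort}[-]$, $\mathrm{open}[-]$. A term is normal if it admits no reduction step. Subformulas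 of a type are defined as usual (e.g. the subformulas of $\Box A$ are $\Box A$ and the subformulas of $A$). -}

module Defs where

open import Data.Nat using (ℕ; zero; suc; _⊔_; _≡ᵇ_; _≟_)
open import Data.Bool using (if_then_else_)
open import Data.List using (List; []; _∷_; _++_; filter; concatMap; foldr)
open import Data.Product using (Σ; _×_; _,_)
open import Data.Sum using (_⊎_)
open import Relation.Nullary using (¬_; ¬?)

infixr 30 _⊗_
infixr 25 _⊕_
infixr 20 _⇒_

data Ty : Set where
  atom : ℕ → Ty
  𝟙    : Ty
  _⊗_  : Ty → Ty → Ty
  _⇒_  : Ty → Ty → Ty
  𝟘    : Ty
  _⊕_  : Ty → Ty → Ty
  □_   : Ty → Ty

data _≼_ : Ty → Ty → Set where
  ≼refl : ∀ {A} → A ≼ A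
  ≼⊗ˡ   : ∀ {A B C} → A ≼ B → A ≼ (B ⊗ C)
  ≼⊗ʳ   : ∀ {A B C} → A ≼ C → A ≼ (B ⊗ C)
  ≼⇒ˡ   : ∀ {A B C} → A ≼ B → A ≼ (B ⇒ C)
  ≼⇒ʳ   : ∀ {A B C} → A ≼ C → A ≼ (B ⇒ C)
  ≼⊕ˡ   : ∀ {A B C} → A ≼ B → A ≼ (B ⊕ C)
  ≼⊕ʳ   : ∀ {A B C} → A ≼ C → A ≼ (B ⊕ C)
  ≼□    : ∀ {A B} → A ≼ B → A ≼ (□ B)

Var : Set
Var = ℕ

data Tm : Set where
  var   : Var → Tm
  unit  : Tm
  pair  : Tm → Tm → Tm
  fst   : Tm → Tm
  snd   : Tm → Tm
  lam   : Var → Tm → Tm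
  app   : Tm → Tm → Tm
  inl   : Tm → Tm
  inr   : Tm → Tm
  case  : Tm → Var → Tm → Var → Tm → Tm   -- case s of (x.t ; y.u)
  abort : Tm → Tm
  shut  : Tm → Tm
  opn   : Tm → Tm

infixl 5 _,_∶_ _,🔒 _++ᶜ_

data Ctx : Set where
  ∙     : Ctx
  _,_∶_ : Ctx → Var → Ty → Ctx
  _,🔒  : Ctx → Ctx

_++ᶜ_ : Ctx → Ctx → Ctx
Γ ++ᶜ ∙         = Γ
Γ ++ᶜ (Δ , x ∶ A) = (Γ ++ᶜ Δ) , x ∶ A
Γ ++ᶜ (Δ ,🔒)     = (Γ ++ᶜ Δ) ,🔒

data LockFree : Ctx → Set where
  lf∙ : LockFree ∙
  lf, : ∀ {Γ x A} → LockFree Γ → LockFree (Γ , x ∶ A)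

data _∈dom_ : Var → Ctx → Set where
  here  : ∀ {Γ x A} → x ∈dom (Γ , x ∶ A)
  there : ∀ {Γ x y A} → x ∈dom Γ → x ∈dom (Γ , y ∶ A)
  lock  : ∀ {Γ x} → x ∈dom Γ → x ∈dom (Γ ,🔒)

data Distinct : Ctx → Set where
  d∙ : Distinct ∙
  d, : ∀ {Γ x A} → Distinct Γ → ¬ (x ∈dom Γ) → Distinct (Γ , x ∶ A)
  d🔒 : ∀ {Γ} → Distinct Γ → Distinct (Γ ,🔒)

data _∈ty_ : Ty → Ctx → Set where
  here  : ∀ {Γ x A} → A ∈ty (Γ , x ∶ A)
  there : ∀ {Γ x A B} → A ∈ty Γ → A ∈ty (Γ , x ∶ B)
  lock  : ∀ {Γ A} → A ∈ty Γ → A ∈ty (Γ ,🔒)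

-- Typing derivations (Fitch-style calculus for IK)
-- Side conditions ¬ (x ∈dom …) express that extended contexts still have
-- distinct variables.

infix 3 _⊢_∶_

data _⊢_∶_ : Ctx → Tm → Ty → Set where
  ⊢var   : ∀ {Γ x A Γ'} → LockFree Γ' → (Γ , x ∶ A) ++ᶜ Γ' ⊢ var x ∶ A
  ⊢unit  : ∀ {Γ} → Γ ⊢ unit ∶ 𝟙
  ⊢pair  : ∀ {Γ t u A B} → Γ ⊢ t ∶ A → Γ ⊢ u ∶ B → Γ ⊢ pair t u ∶ A ⊗ B
  ⊢fst   : ∀ {Γ t A B} → Γ ⊢ t ∶ A ⊗ B → Γ ⊢ fst t ∶ A
  ⊢snd   : ∀ {Γ t A B} → Γ ⊢ t ∶ A ⊗ B → Γ ⊢ snd t ∶ B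
  ⊢lam   : ∀ {Γ x t A B} → ¬ (x ∈dom Γ) → Γ , x ∶ A ⊢ t ∶ B → Γ ⊢ lam x t ∶ A ⇒ B
  ⊢app   : ∀ {Γ t u A B} → Γ ⊢ t ∶ A ⇒ B → Γ ⊢ u ∶ A → Γ ⊢ app t u ∶ B
  ⊢inl   : ∀ {Γ t A B} → Γ ⊢ t ∶ A → Γ ⊢ inl t ∶ A ⊕ B
  ⊢inr   : ∀ {Γ t A B} → Γ ⊢ t ∶ B → Γ ⊢ inr t ∶ A ⊕ B
  ⊢case  : ∀ {Γ Γ' s x t y u A B C} →
           ¬ (x ∈dom (Γ ++ᶜ Γ')) → ¬ (y ∈dom (Γ ++ᶜ Γ')) →
           Γ ⊢ s ∶ A ⊕ B →
           (Γ , x ∶ A) ++ᶜ Γ' ⊢ t ∶ C →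
           (Γ , y ∶ B) ++ᶜ Γ' ⊢ u ∶ C →
           Γ ++ᶜ Γ' ⊢ case s x t y u ∶ C
  ⊢abort : ∀ {Γ Γ' t A} → Γ ⊢ t ∶ 𝟘 → Γ ++ᶜ Γ' ⊢ abort t ∶ A
  ⊢shut  : ∀ {Γ t A} → Γ ,🔒 ⊢ t ∶ A → Γ ⊢ shut t ∶ □ A
  ⊢open  : ∀ {Γ Γ' t A} → LockFree Γ' → Γ ⊢ t ∶ □ A → (Γ ,🔒) ++ᶜ Γ' ⊢ opn t ∶ A

-- Every P D : the type of every node (judgement) of the derivation tree D
-- satisfies P.  The nodes of D are exactly the subterm occurrences of t.
Every : (Ty → Set) → ∀ {Γ t A} → Γ ⊢ t ∶ A → Set
Every P {A = A} (⊢var _)           = P A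
Every P {A = A} ⊢unit              = P A
Every P {A = A} (⊢pair d e)        = P A × Every P d × Every P e
Every P {A = A} (⊢fst d)           = P A × Every P d
Every P {A = A} (⊢snd d)           = P A × Every P d
Every P {A = A} (⊢lam _ d)         = P A × Every P d
Every P {A = A} (⊢app d e)         = P A × Every P d × Every P e
Every P {A = A} (⊢inl d)           = P A × Every P d
Every P {A = A} (⊢inr d)           = P A × Every P d
Every P {A = A} (⊢case _ _ d e f)  = P A × Every P d × Every P e × Every P f
Every P {A = A} (⊢abort d)         = P A × Every P d
Every P {A = A} (⊢shut d)          = P A × Every P d
Every P {A = A} (⊢open _ d)        = P A × Every P d

fv : Tm → List Var
fv (var x)          = x ∷ []
fv unit             = []
fv (pair t u)       = fv t ++ fv u
fv (fst t)          = fv t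
fv (snd t)          = fv t
fv (lam x t)        = filter (λ z → ¬? (z ≟ x)) (fv t)
fv (app t u)        = fv t ++ fv u
fv (inl t)          = fv t
fv (inr t)          = fv t
fv (case s x t y u) = fv s ++ filter (λ z → ¬? (z ≟ x)) (fv t)
                           ++ filter (λ z → ¬? (z ≟ y)) (fv u)
fv (abort t)        = fv t
fv (shut t)         = fv t
fv (opn t)          = fv t

Sub : Set
Sub = Var → Tm

_[_↦_] : Sub → Var → Tm → Sub
(σ [ x ↦ u ]) y = if y ≡ᵇ x then u else σ y

-- a name not free in σ y for any y free in the binder body (minus x)
freshFor : Sub → Var → Tm → Var
freshFor σ x t = suc (foldr _⊔_ 0 (concatMap (λ y → fv (σ y)) (fv (lam x t))))

subst : Sub → Tm → Tm
subst σ (var x)    = σ x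
subst σ unit       = unit
subst σ (pair t u) = pair (subst σ t) (subst σ u)
subst σ (fst t)    = fst (subst σ t)
subst σ (snd t)    = snd (subst σ t)
subst σ (lam x t)  = lam z (subst (σ [ x ↦ var z ]) t)
  where z = freshFor σ x t
subst σ (app t u)  = app (subst σ t) (subst σ u)
subst σ (inl t)    = inl (subst σ t)
subst σ (inr t)    = inr (subst σ t)
subst σ (case s x t y u) =
  case (subst σ s) z₁ (subst (σ [ x ↦ var z₁ ]) t) z₂ (subst (σ [ y ↦ var z₂ ]) u)
  where z₁ = freshFor σ x t
        z₂ = freshFor σ y u
subst σ (abort t)  = abort (subst σ t)
subst σ (shut t)   = shut (subst σ t)
subst σ (opn t)    = opn (subst σ t)

_[_/_] : Tm → Tm → Var → Tm
t [ u / x ] = subst (var [ x ↦ u ]) t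

data Frame : Set where
  appF   : Tm → Frame
  fstF   : Frame
  sndF   : Frame
  caseF  : Var → Tm → Var → Tm → Frame
  abortF : Frame
  openF  : Frame

plug : Frame → Tm → Tm
plug (appF v)        t = app t v
plug fstF            t = fst t
plug sndF            t = snd t
plug (caseF x a y b) t = case t x a y b
plug abortF          t = abort t
plug openF           t = opn t

infix 3 _↦_

data _↦_ : Tm → Tm → Set where
  β→    : ∀ {x t u} → app (lam x t) u ↦ t [ u / x ]
  β×₁   : ∀ {t u} → fst (pair t u) ↦ t
  β×₂   : ∀ {t u} → snd (pair t u) ↦ u
  β+₁   : ∀ {s x t y u} → case (inl s) x t y u ↦ t [ s / x ]
  β+₂   : ∀ {s x t y u} → case (inr s) x t y u ↦ u [ s / y ]
  β□    : ∀ {t} → opn (shut t) ↦ t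
  κcase : ∀ {E s x t y u} →
          plug E (case s x t y u) ↦ case s x (plug E t) y (plug E u)
  κabort : ∀ {E t} → plug E (abort t) ↦ abort t
  ξpair₁ : ∀ {t t' u} → t ↦ t' → pair t u ↦ pair t' u
  ξpair₂ : ∀ {t u u'} → u ↦ u' → pair t u ↦ pair t u'
  ξfst   : ∀ {t t'} → t ↦ t' → fst t ↦ fst t'
  ξsnd   : ∀ {t t'} → t ↦ t' → snd t ↦ snd t'
  ξlam   : ∀ {x t t'} → t ↦ t' → lam x t ↦ lam x t'
  ξapp₁  : ∀ {t t' u} → t ↦ t' → app t u ↦ app t' u
  ξapp₂  : ∀ {t u u'} → u ↦ u' → app t u ↦ app t u'
  ξinl   : ∀ {t t'} → t ↦ t' → inl t ↦ inl t'
  ξinr   : ∀ {t t'} → t ↦ t' → inr t ↦ inr t'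
  ξcase₁ : ∀ {s s' x t y u} → s ↦ s' → case s x t y u ↦ case s' x t y u
  ξcase₂ : ∀ {s x t t' y u} → t ↦ t' → case s x t y u ↦ case s x t' y u
  ξcase₃ : ∀ {s x t y u u'} → u ↦ u' → case s x t y u ↦ case s x t y u'
  ξabort : ∀ {t t'} → t ↦ t' → abort t ↦ abort t'
  ξshut  : ∀ {t t'} → t ↦ t' → shut t ↦ shut t'
  ξopen  : ∀ {t t'} → t ↦ t' → opn t ↦ opn t'

Normal : Tm → Set
Normal t = ∀ t' → ¬ (t ↦ t')

SubformulaOf : Ctx → Ty → Ty → Set
SubformulaOf Γ A B = B ≼ A ⊎ Σ Ty (λ C → C ∈ty Γ × B ≼ C)

-- In a normal term the principal premise of every elimination is itself an
-- elimination (an introduction there would form a β-redex, a case or abort a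
-- commuting redex), so eliminations form spines headed by a variable.  Along
-- such a spine every type is a subformula of the variable's type, hence of a
-- context type.  Introductions only produce subformulas of their conclusion,
-- and the variables they or a case bind carry subformulas of the conclusion
-- or of the type of a spine, which closes the induction.
module Submission where

open import Defs
open import Data.Product using (Σ; _×_; _,_; proj₁)
open import Data.Sum using (_⊎_; inj₁; inj₂; [_,_]′; map; map₁; map₂)
open import Data.Empty using (⊥-elim)
open import Function using (_∘_)
open import Relation.Binary.PropositionalEquality using (_≡_; refl)

≼-trans : ∀ {A B C} → A ≼ B → B ≼ C → A ≼ C
≼-trans p ≼refl   = p
≼-trans p (≼⊗ˡ q) = ≼⊗ˡ (≼-trans p q)
≼-trans p (≼⊗ʳ q) = ≼⊗ʳ (≼-trans p q)
≼-trans p (≼⇒ˡ q) = ≼⇒ˡ (≼-trans p q)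
≼-trans p (≼⇒ʳ q) = ≼⇒ʳ (≼-trans p q)
≼-trans p (≼⊕ˡ q) = ≼⊕ˡ (≼-trans p q)
≼-trans p (≼⊕ʳ q) = ≼⊕ʳ (≼-trans p q)
≼-trans p (≼□ q)  = ≼□ (≼-trans p q)

infix 4 _≼ᶜ_ _⊆ᵗ_

_≼ᶜ_ : Ty → Ctx → Set
B ≼ᶜ Γ = Σ Ty (λ C → C ∈ty Γ × B ≼ C)

_⊆ᵗ_ : Ctx → Ctx → Set
Γ ⊆ᵗ Δ = ∀ {C} → C ∈ty Γ → C ∈ty Δ

⊆ᵗ-++ᶜʳ : ∀ {Γ} Γ' → Γ ⊆ᵗ Γ ++ᶜ Γ'
⊆ᵗ-++ᶜʳ ∙            c = c
⊆ᵗ-++ᶜʳ (Γ' , _ ∶ _) c = there (⊆ᵗ-++ᶜʳ Γ' c)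
⊆ᵗ-++ᶜʳ (Γ' ,🔒)     c = lock (⊆ᵗ-++ᶜʳ Γ' c)

∈ty-split : ∀ {Γ x A C} Γ' → C ∈ty ((Γ , x ∶ A) ++ᶜ Γ') → C ≡ A ⊎ C ∈ty (Γ ++ᶜ Γ')
∈ty-split ∙            here      = inj₁ refl
∈ty-split ∙            (there c) = inj₂ c
∈ty-split (Γ' , _ ∶ _) here      = inj₂ here
∈ty-split (Γ' , _ ∶ _) (there c) = map₂ there (∈ty-split Γ' c)
∈ty-split (Γ' ,🔒)     (lock c)  = map₂ lock (∈ty-split Γ' c)

≼ᶜ-mono : ∀ {Γ Δ B} → Γ ⊆ᵗ Δ → B ≼ᶜ Γ → B ≼ᶜ Δ
≼ᶜ-mono Γ⊆Δ (C , c , q) = C , Γ⊆Δ c , q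

≼-≼ᶜ-trans : ∀ {Γ A B} → A ≼ B → B ≼ᶜ Γ → A ≼ᶜ Γ
≼-≼ᶜ-trans p (C , c , q) = C , c , ≼-trans p q

≼ᶜ-split : ∀ {Γ x A B} Γ' → B ≼ᶜ (Γ , x ∶ A) ++ᶜ Γ' → B ≼ A ⊎ (B ≼ᶜ Γ ++ᶜ Γ')
≼ᶜ-split Γ' (C , c , q) with ∈ty-split Γ' c
... | inj₁ refl = inj₁ q
... | inj₂ c'   = inj₂ (C , c' , q)

≼ᶜ-unlock : ∀ {Γ B} → B ≼ᶜ Γ ,🔒 → B ≼ᶜ Γ
≼ᶜ-unlock (C , lock c , q) = C , c , q

SubformulaOf-widen : ∀ {Γ A A' B} → A ≼ A' → SubformulaOf Γ A B → SubformulaOf Γ A' B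
SubformulaOf-widen p = map₁ (λ q → ≼-trans q p)

SubformulaOf-lam : ∀ {Γ x A B C} → SubformulaOf (Γ , x ∶ A) B C → SubformulaOf Γ (A ⇒ B) C
SubformulaOf-lam (inj₁ p) = inj₁ (≼⇒ʳ p)
SubformulaOf-lam (inj₂ c) = map₁ ≼⇒ˡ (≼ᶜ-split ∙ c)

SubformulaOf-shut : ∀ {Γ A C} → SubformulaOf (Γ ,🔒) A C → SubformulaOf Γ (□ A) C
SubformulaOf-shut = map ≼□ ≼ᶜ-unlock

SubformulaOf-discharge : ∀ {Γ x A B C} Γ' → A ≼ᶜ Γ ++ᶜ Γ' →
  SubformulaOf ((Γ , x ∶ A) ++ᶜ Γ') B C → SubformulaOf (Γ ++ᶜ Γ') B C
SubformulaOf-discharge Γ' a (inj₁ p) = inj₁ p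
SubformulaOf-discharge Γ' a (inj₂ c) = inj₂ ([ (λ p → ≼-≼ᶜ-trans p a) , (λ c' → c') ]′ (≼ᶜ-split Γ' c))

Every-map : ∀ {P Q : Ty → Set} → (∀ {B} → P B → Q B) →
  ∀ {Γ t A} (D : Γ ⊢ t ∶ A) → Every P D → Every Q D
Every-map f (⊢var _)          e               = f e
Every-map f ⊢unit             e               = f e
Every-map f (⊢pair d d')      (a , e , e')    = f a , Every-map f d e , Every-map f d' e'
Every-map f (⊢fst d)          (a , e)         = f a , Every-map f d e
Every-map f (⊢snd d)          (a , e)         = f a , Every-map f d e
Every-map f (⊢lam _ d)        (a , e)         = f a , Every-map f d e
Every-map f (⊢app d d')       (a , e , e')    = f a , Every-map f d e , Every-map f d' e'
Every-map f (⊢inl d)          (a , e)         = f a , Every-map f d e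
Every-map f (⊢inr d)          (a , e)         = f a , Every-map f d e
Every-map f (⊢case _ _ d d' d'') (a , e , e' , e'') =
  f a , Every-map f d e , Every-map f d' e' , Every-map f d'' e''
Every-map f (⊢abort d)        (a , e)         = f a , Every-map f d e
Every-map f (⊢shut d)         (a , e)         = f a , Every-map f d e
Every-map f (⊢open _ d)       (a , e)         = f a , Every-map f d e

Every-root : ∀ {P : Ty → Set} {Γ t A} (D : Γ ⊢ t ∶ A) → Every P D → P A
Every-root (⊢var _)           e = e
Every-root ⊢unit              e = e
Every-root (⊢pair _ _)        e = proj₁ e
Every-root (⊢fst _)           e = proj₁ e
Every-root (⊢snd _)           e = proj₁ e
Every-root (⊢lam _ _)         e = proj₁ e
Every-root (⊢app _ _)         e = proj₁ e
Every-root (⊢inl _)           e = proj₁ e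
Every-root (⊢inr _)           e = proj₁ e
Every-root (⊢case _ _ _ _ _)  e = proj₁ e
Every-root (⊢abort _)         e = proj₁ e
Every-root (⊢shut _)          e = proj₁ e
Every-root (⊢open _ _)        e = proj₁ e

normal-under : ∀ {t u} {F : Tm → Tm} → (∀ {t'} → t ↦ t' → u ↦ F t') → Normal u → Normal t
normal-under ξ n t' s = n _ (ξ s)

data ElimForm : Tm → Set where
  var : ∀ {x} → ElimForm (var x)
  fst : ∀ {t} → ElimForm (fst t)
  snd : ∀ {t} → ElimForm (snd t)
  app : ∀ {t u} → ElimForm (app t u)
  opn : ∀ {t} → ElimForm (opn t)

normal-fst-elim : ∀ {Γ t A B} → Γ ⊢ t ∶ A ⊗ B → Normal (fst t) → ElimForm t
normal-fst-elim (⊢var _)          n = var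
normal-fst-elim (⊢pair _ _)       n = ⊥-elim (n _ β×₁)
normal-fst-elim (⊢fst _)          n = fst
normal-fst-elim (⊢snd _)          n = snd
normal-fst-elim (⊢app _ _)        n = app
normal-fst-elim (⊢case _ _ _ _ _) n = ⊥-elim (n _ (κcase {E = fstF}))
normal-fst-elim (⊢abort _)        n = ⊥-elim (n _ (κabort {E = fstF}))
normal-fst-elim (⊢open _ _)       n = opn

normal-snd-elim : ∀ {Γ t A B} → Γ ⊢ t ∶ A ⊗ B → Normal (snd t) → ElimForm t
normal-snd-elim (⊢var _)          n = var
normal-snd-elim (⊢pair _ _)       n = ⊥-elim (n _ β×₂)
normal-snd-elim (⊢fst _)          n = fst
normal-snd-elim (⊢snd _)          n = snd
normal-snd-elim (⊢app _ _)        n = app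
normal-snd-elim (⊢case _ _ _ _ _) n = ⊥-elim (n _ (κcase {E = sndF}))
normal-snd-elim (⊢abort _)        n = ⊥-elim (n _ (κabort {E = sndF}))
normal-snd-elim (⊢open _ _)       n = opn

normal-app-elim : ∀ {Γ t u A B} → Γ ⊢ t ∶ A ⇒ B → Normal (app t u) → ElimForm t
normal-app-elim     (⊢var _)          n = var
normal-app-elim     (⊢lam _ _)        n = ⊥-elim (n _ β→)
normal-app-elim     (⊢fst _)          n = fst
normal-app-elim     (⊢snd _)          n = snd
normal-app-elim     (⊢app _ _)        n = app
normal-app-elim {u = u} (⊢case _ _ _ _ _) n = ⊥-elim (n _ (κcase {E = appF u}))
normal-app-elim {u = u} (⊢abort _)    n = ⊥-elim (n _ (κabort {E = appF u}))
normal-app-elim     (⊢open _ _)       n = opn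

normal-open-elim : ∀ {Γ t A} → Γ ⊢ t ∶ □ A → Normal (opn t) → ElimForm t
normal-open-elim (⊢var _)          n = var
normal-open-elim (⊢shut _)         n = ⊥-elim (n _ β□)
normal-open-elim (⊢fst _)          n = fst
normal-open-elim (⊢snd _)          n = snd
normal-open-elim (⊢app _ _)        n = app
normal-open-elim (⊢case _ _ _ _ _) n = ⊥-elim (n _ (κcase {E = openF}))
normal-open-elim (⊢abort _)        n = ⊥-elim (n _ (κabort {E = openF}))
normal-open-elim (⊢open _ _)       n = opn

normal-case-elim : ∀ {Γ s x t y u A B} → Γ ⊢ s ∶ A ⊕ B → Normal (case s x t y u) → ElimForm s
normal-case-elim (⊢var _)          n = var
normal-case-elim (⊢inl _)          n = ⊥-elim (n _ β+₁)
normal-case-elim (⊢inr _)          n = ⊥-elim (n _ β+₂)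
normal-case-elim (⊢fst _)          n = fst
normal-case-elim (⊢snd _)          n = snd
normal-case-elim (⊢app _ _)        n = app
normal-case-elim {x = x} {t} {y} {u} (⊢case _ _ _ _ _) n = ⊥-elim (n _ (κcase {E = caseF x t y u}))
normal-case-elim {x = x} {t} {y} {u} (⊢abort _)        n = ⊥-elim (n _ (κabort {E = caseF x t y u}))
normal-case-elim (⊢open _ _)       n = opn

normal-abort-elim : ∀ {Γ t} → Γ ⊢ t ∶ 𝟘 → Normal (abort t) → ElimForm t
normal-abort-elim (⊢var _)          n = var
normal-abort-elim (⊢fst _)          n = fst
normal-abort-elim (⊢snd _)          n = snd
normal-abort-elim (⊢app _ _)        n = app
normal-abort-elim (⊢case _ _ _ _ _) n = ⊥-elim (n _ (κcase {E = abortF}))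
normal-abort-elim (⊢abort _)        n = ⊥-elim (n _ (κabort {E = abortF}))
normal-abort-elim (⊢open _ _)       n = opn

mutual
  elim-subformulas : ∀ {Γ t A} (D : Γ ⊢ t ∶ A) → ElimForm t → Normal t →
    Every (_≼ᶜ Γ) D
  elim-subformulas (⊢var {A = A} {Γ' = Γ'} _) var n = A , ⊆ᵗ-++ᶜʳ Γ' here , ≼refl
  elim-subformulas (⊢fst d) fst n =
    ≼-≼ᶜ-trans (≼⊗ˡ ≼refl) (Every-root d e) , e
    where e = elim-subformulas d (normal-fst-elim d n) (normal-under ξfst n)
  elim-subformulas (⊢snd d) snd n =
    ≼-≼ᶜ-trans (≼⊗ʳ ≼refl) (Every-root d e) , e
    where e = elim-subformulas d (normal-snd-elim d n) (normal-under ξsnd n)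
  elim-subformulas (⊢app d d') app n =
    ≼-≼ᶜ-trans (≼⇒ʳ ≼refl) f ,
    e ,
    Every-map [ (λ p → ≼-≼ᶜ-trans (≼⇒ˡ p) f) , (λ c → c) ]′ d'
      (normal-subformulas d' (normal-under ξapp₂ n))
    where e = elim-subformulas d (normal-app-elim d n) (normal-under ξapp₁ n)
          f = Every-root d e
  elim-subformulas (⊢open {Γ' = Γ'} _ d) opn n =
    ≼-≼ᶜ-trans (≼□ ≼refl) (lift (Every-root d e)) , Every-map lift d e
    where e = elim-subformulas d (normal-open-elim d n) (normal-under ξopen n)
          lift : ∀ {Γ B} → B ≼ᶜ Γ → B ≼ᶜ (Γ ,🔒) ++ᶜ Γ'
          lift = ≼ᶜ-mono (⊆ᵗ-++ᶜʳ Γ' ∘ lock)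

  normal-subformulas : ∀ {Γ t A} (D : Γ ⊢ t ∶ A) → Normal t →
    Every (SubformulaOf Γ A) D
  normal-subformulas (⊢var _)     n = inj₁ ≼refl
  normal-subformulas D@(⊢fst _)   n = Every-map inj₂ D (elim-subformulas D fst n)
  normal-subformulas D@(⊢snd _)   n = Every-map inj₂ D (elim-subformulas D snd n)
  normal-subformulas D@(⊢app _ _) n = Every-map inj₂ D (elim-subformulas D app n)
  normal-subformulas D@(⊢open _ _) n = Every-map inj₂ D (elim-subformulas D opn n)
  normal-subformulas ⊢unit n = inj₁ ≼refl
  normal-subformulas (⊢pair d d') n =
    inj₁ ≼refl ,
    Every-map (SubformulaOf-widen (≼⊗ˡ ≼refl)) d (normal-subformulas d (normal-under ξpair₁ n)) ,
    Every-map (SubformulaOf-widen (≼⊗ʳ ≼refl)) d' (normal-subformulas d' (normal-under ξpair₂ n))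
  normal-subformulas (⊢lam _ d) n =
    inj₁ ≼refl , Every-map SubformulaOf-lam d (normal-subformulas d (normal-under ξlam n))
  normal-subformulas (⊢inl d) n =
    inj₁ ≼refl ,
    Every-map (SubformulaOf-widen (≼⊕ˡ ≼refl)) d (normal-subformulas d (normal-under ξinl n))
  normal-subformulas (⊢inr d) n =
    inj₁ ≼refl ,
    Every-map (SubformulaOf-widen (≼⊕ʳ ≼refl)) d (normal-subformulas d (normal-under ξinr n))
  normal-subformulas (⊢shut d) n =
    inj₁ ≼refl , Every-map SubformulaOf-shut d (normal-subformulas d (normal-under ξshut n))
  normal-subformulas (⊢abort {Γ' = Γ'} d) n =
    inj₁ ≼refl ,
    Every-map (inj₂ ∘ ≼ᶜ-mono (⊆ᵗ-++ᶜʳ Γ')) d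
      (elim-subformulas d (normal-abort-elim d n) (normal-under ξabort n))
  normal-subformulas (⊢case {Γ' = Γ'} _ _ ds dt du) n =
    inj₁ ≼refl ,
    Every-map (inj₂ ∘ ≼ᶜ-mono (⊆ᵗ-++ᶜʳ Γ')) ds e ,
    Every-map (SubformulaOf-discharge Γ' (≼-≼ᶜ-trans (≼⊕ˡ ≼refl) s)) dt
      (normal-subformulas dt (normal-under ξcase₂ n)) ,
    Every-map (SubformulaOf-discharge Γ' (≼-≼ᶜ-trans (≼⊕ʳ ≼refl) s)) du
      (normal-subformulas du (normal-under ξcase₃ n))
    where e = elim-subformulas ds (normal-case-elim ds n) (normal-under ξcase₁ n)
          s = ≼ᶜ-mono (⊆ᵗ-++ᶜʳ Γ') (Every-root ds e)

theorem5 : ∀ {Γ t A} → Distinct Γ → (D : Γ ⊢ t ∶ A) → Normal t →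
    Every (SubformulaOf Γ A) D
theorem5 _ = normal-subformulas
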